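{- Let $k,\ell\ge1$ be integers and let $A_x$ be a digraph on $3+2k(\ell+1)$ vertices consisting of: (i) a cycle $C$ on the $4k+3$ distinct vertices $x_s,x,s_1,t_1,\dots,s_{2k},t_{2k},x_t$ whose arcs are $(x_s,x)$, $(x,s_1)$, $(t_i,s_{i+1})$ for $1\le i\le 2k-1$, $(t_{2k},x_t)$, $(x_s,s_2)$, $(t_{2j},s_{2j+2})$ and $(t_{2j-1},s_{2j+1})$ for $1\le j\le k-1$, $(t_{2k-1},x_t)$ and $(t_{2k},s_1)$; and (ii) $2k$ directed paths $P_i$ from $s_i$ to $t_i$ ($i\in[2k]$), each of length $\ell$, pairwise disjoint, whose internal vertices are not on $C$. Then $A_x$ is an absorber for $x$ with starting point $x_s$ and terminal point $x_t$: it contains a directed $x_s x_t$-path using all vertices of $A_x$, and a directed $x_s x_t$-path using all vertices of $A_x$ except $x$.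
   Context: Length of a path means its number of arcs. An absorber for a vertex $x$ with starting point $s_x$ and terminal point $t_x$ is a digraph $A_x$ on $\ell_x+1$ vertices containing a directed $s_xt_x$-path of length $\ell_x-1$ avoiding $x$ (non-absorbing path) and a directed $s_xt_x$-path of length $\ell_x$ (absorbing path). -}

module Defs where

open import Data.Nat using (ℕ; zero; suc; _+_; _*_; _≤_; _∸_)
open import Data.Fin using (Fin; toℕ)
open import Data.List using (List; head; last)
open import Data.Maybe using (just)
open import Data.List.Relation.Unary.Linked using (Linked)
open import Data.List.Relation.Unary.Unique.Propositional using (Unique)
open import Data.List.Membership.Propositional using (_∈_; _∉_)
open import Relation.Binary.PropositionalEquality using (_≡_)
open import Relation.Nullary using (¬_)

-- Labels of the vertices of the absorber A_x.
-- xs = x_s, xx = x, xt = x_t, and  pv i j  is the j-th vertex (j = 0..ℓ) of the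
-- path P_{i+1} (paper indices are 1-based; Fin indices are 0-based).
-- So s_{i+1} = pv i 0 and t_{i+1} = pv i ℓ.
data Label (k ℓ : ℕ) : Set where
  xs xx xt : Label k ℓ
  pv : Fin (2 * k) → Fin (suc ℓ) → Label k ℓ

IsT : {ℓ : ℕ} → Fin (suc ℓ) → Set
IsT {ℓ} j = toℕ j ≡ ℓ

IsS : {ℓ : ℕ} → Fin (suc ℓ) → Set
IsS j = toℕ j ≡ 0

-- The arcs of A_x, in terms of labels.  For path indices a : Fin (2k),
-- the paper index is  toℕ a + 1.
data SpecArc (k ℓ : ℕ) : Label k ℓ → Label k ℓ → Set where
  a-xs-x   : SpecArc k ℓ xs xx
  a-x-s1   : ∀ b j → toℕ b ≡ 0 → IsS j → SpecArc k ℓ xx (pv b j)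
  a-ti-si+1 : ∀ a i b j → IsT i → IsS j → toℕ b ≡ suc (toℕ a) →
              SpecArc k ℓ (pv a i) (pv b j)
  a-t2k-xt : ∀ a i → IsT i → suc (toℕ a) ≡ 2 * k → SpecArc k ℓ (pv a i) xt
  a-xs-s2  : ∀ b j → IsS j → suc (toℕ b) ≡ 2 → SpecArc k ℓ xs (pv b j)
  a-even   : ∀ m a i b j → 1 ≤ m → m ≤ k ∸ 1 → IsT i → IsS j →
             suc (toℕ a) ≡ 2 * m → suc (toℕ b) ≡ 2 * m + 2 →
             SpecArc k ℓ (pv a i) (pv b j)
  a-odd    : ∀ m a i b j → 1 ≤ m → m ≤ k ∸ 1 → IsT i → IsS j →
             suc (toℕ a) ≡ 2 * m ∸ 1 → suc (toℕ b) ≡ 2 * m + 1 →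
             SpecArc k ℓ (pv a i) (pv b j)
  a-t2k-1-xt : ∀ a i → IsT i → suc (toℕ a) ≡ 2 * k ∸ 1 → SpecArc k ℓ (pv a i) xt
  a-t2k-s1 : ∀ a i b j → IsT i → IsS j → suc (toℕ a) ≡ 2 * k → toℕ b ≡ 0 →
             SpecArc k ℓ (pv a i) (pv b j)
  a-path   : ∀ a i j → toℕ j ≡ suc (toℕ i) → SpecArc k ℓ (pv a i) (pv a j)

record DiPath {V : Set} (E : V → V → Set) (s t : V) : Set where
  field
    verts  : List V
    linked : Linked E verts
    unique : Unique verts
    starts : head verts ≡ just s
    ends   : last verts ≡ just t
open DiPath public

Spanning : {V : Set} {E : V → V → Set} {s t : V} → DiPath E s t → Set
Spanning {V} P = (v : V) → v ∈ verts P

SpanningExcept : {V : Set} {E : V → V → Set} {s t : V} → V → DiPath E s t → Set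
SpanningExcept {V} x P = (x ∉ verts P) × ((v : V) → ¬ (v ≡ x) → v ∈ verts P)
  where open import Data.Product using (_×_)

-- Split A_x into the segments {x_s}, {x}, {x_t}, P_1, …, P_{2k}.  Walking the
-- segments in the order x_s, x, P_1, P_2, …, P_{2k}, x_t uses the cycle arcs
-- (t_i, s_{i+1}); walking them as x_s, P_2, P_4, …, P_{2k}, P_1, P_3, …, P_{2k-1}, x_t
-- uses the arcs (t_i, s_{i+2}) and (t_{2k}, s_1) and skips x.  Both walks repeat
-- no segment, hence no vertex, and a duplicate-free list of 3 + 2k(ℓ+1), resp.
-- 2 + 2k(ℓ+1), vertices of a digraph on 3 + 2k(ℓ+1) vertices covers everything
-- (resp. everything but x).
module Submission where

open import Data.Empty using (⊥-elim)
open import Data.Fin using (Fin; toℕ; fromℕ; fromℕ<; inject₁)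
  renaming (zero to fzero; suc to fsuc; _≟_ to _≟ᶠ_)
open import Data.Fin.Properties
  using (toℕ-fromℕ; toℕ-fromℕ<; toℕ-inject₁; toℕ-injective; toℕ<n; injective⇒≤)
open import Data.List
  using (List; []; _∷_; _++_; [_]; map; concatMap; length; head; last; lookup; tabulate; allFin)
open import Data.List.Properties
  using (length-++; length-map; length-tabulate; head-map; last-map; concatMap-++)
open import Data.List.Membership.Propositional using (_∈_; _∉_; find)
open import Data.List.Membership.Propositional.Properties
  using (∈-map⁻; ∈-++⁻; ∈-concatMap⁻; ∈-lookup; ∈-tabulate⁻)
open import Data.List.Relation.Binary.Disjoint.Propositional using (Disjoint)
open import Data.List.Relation.Unary.All as All using (All; []; _∷_)
import Data.List.Relation.Unary.All.Properties as All
import Data.List.Relation.Unary.AllPairs as AllPairs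
import Data.List.Relation.Unary.AllPairs.Properties as AllPairs
open import Data.List.Relation.Unary.Any using (here; there; any?)
open import Data.List.Relation.Unary.Linked as Linked using (Linked; []; [-]; _∷_)
import Data.List.Relation.Unary.Linked.Properties as Linked
open import Data.List.Relation.Unary.Unique.Propositional using (Unique; []; _∷_)
import Data.List.Relation.Unary.Unique.Propositional.Properties as Unique
open import Data.Maybe using (just; nothing)
import Data.Maybe as Maybe
open import Data.Maybe.Relation.Binary.Connected using (Connected; just; just-nothing; nothing)
open import Data.Nat using (ℕ; zero; suc; _+_; _*_; _∸_; _≤_; _<_; s≤s; z≤n)
open import Data.Nat.Divisibility using (_∣_; ∣⇒≤; ∣m+n∣m⇒∣n; m∣m*n)
open import Data.Nat.Properties
  using (+-comm; +-identityʳ; *-suc; *-monoʳ-≤; *-cancelˡ-<; *-cancelˡ-≡; <⇒≤; <⇒≤pred;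
         n<1+n; <-trans; ≤-trans; ≤-reflexive; 1+n≰n; suc-injective)
open import Data.Sum using (inj₁; inj₂)
open import Data.Product using (Σ; ∃₂; _×_; _,_)
open import Function using (_∘_; id)
open import Function.Bundles using (_⇔_; Equivalence)
open import Function.Definitions using (Injective)
open import Relation.Binary.PropositionalEquality
  using (_≡_; _≢_; refl; sym; trans; cong; cong₂; subst; module ≡-Reasoning)
open import Relation.Nullary using (¬_; yes; no)

open import Defs

module _ {A : Set} where

  ∉⇒unique-∷ : ∀ {x} {ws : List A} → x ∉ ws → Unique ws → Unique (x ∷ ws)
  ∉⇒unique-∷ {ws = ws} x∉ws u = All.¬Any⇒All¬ ws x∉ws ∷ u

  lookup-injective : ∀ {ws : List A} → Unique ws → Injective _≡_ _≡_ (lookup ws)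
  lookup-injective (_ ∷ _)      {fzero}  {fzero}  _  = refl
  lookup-injective (x≢ ∷ _)     {fzero}  {fsuc j} eq = ⊥-elim (All.lookup x≢ (∈-lookup j) eq)
  lookup-injective (x≢ ∷ _)     {fsuc i} {fzero}  eq = ⊥-elim (All.lookup x≢ (∈-lookup i) (sym eq))
  lookup-injective (_ ∷ u)      {fsuc i} {fsuc j} eq = cong fsuc (lookup-injective u eq)

  head-++ : ∀ (ws : List A) {ys x} → head ws ≡ just x → head (ws ++ ys) ≡ just x
  head-++ (_ ∷ _) refl = refl

  last-++ : ∀ (ws : List A) y ys → last (ws ++ y ∷ ys) ≡ last (y ∷ ys)
  last-++ []           y ys = refl
  last-++ (_ ∷ [])     y ys = refl
  last-++ (_ ∷ x ∷ ws) y ys = last-++ (x ∷ ws) y ys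

  last-tabulate : ∀ {m} (g : Fin (suc m) → A) → last (tabulate g) ≡ just (g (fromℕ m))
  last-tabulate {zero}  g = refl
  last-tabulate {suc m} g = last-tabulate (g ∘ fsuc)

  module _ {R : A → A → Set} where

    connected-last : ∀ ws {x y} → last ws ≡ just x → R x y → Connected R (last ws) (just y)
    connected-last ws eq r rewrite eq = just r

    linked-tabulate : ∀ {m} (g : Fin (suc m) → A) →
                      (∀ i → R (g (inject₁ i)) (g (fsuc i))) → Linked R (tabulate g)
    linked-tabulate {zero}  g r = [-]
    linked-tabulate {suc m} g r = r fzero ∷ linked-tabulate (g ∘ fsuc) (r ∘ fsuc)

linked-concatMap : ∀ {A B : Set} {R : B → B → Set} (g : A → List B) {entry exit : A → B} →
                   (∀ a → head (g a) ≡ just (entry a)) → (∀ a → last (g a) ≡ just (exit a)) →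
                   (∀ a → Linked R (g a)) →
                   ∀ {ws} → Linked (λ a b → R (exit a) (entry b)) ws → Linked R (concatMap g ws)
linked-concatMap g heads lasts linked [] = []
linked-concatMap g heads lasts linked {a ∷ []} [-] =
  Linked.++⁺ (linked a) (connected-nothing (last (g a))) []
  where
  connected-nothing : ∀ m → Connected _ m nothing
  connected-nothing (just _) = just-nothing
  connected-nothing nothing  = nothing
linked-concatMap g heads lasts linked {a ∷ b ∷ ws} (r ∷ rs) =
  Linked.++⁺ (linked a)
             (subst (Connected _ (last (g a))) (sym (head-++ (g b) (heads b)))
                    (connected-last (g a) (lasts a) r))
             (linked-concatMap g heads lasts linked rs)

unique-concatMap : ∀ {A B : Set} (g : A → List B) → (∀ a → Unique (g a)) →
                   (∀ {a b} → a ≢ b → Disjoint (g a) (g b)) →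
                   ∀ {ws} → Unique ws → Unique (concatMap g ws)
unique-concatMap g unique-g disjoint {ws} u =
  Unique.concat⁺ (All.map⁺ (All.universal unique-g ws)) (AllPairs.map⁺ (AllPairs.map disjoint u))

unique-long⇒∈ : ∀ {m} {ws : List (Fin m)} → Unique ws → m ≤ length ws → ∀ v → v ∈ ws
unique-long⇒∈ {ws = ws} u m≤ v with any? (v ≟ᶠ_) ws
... | yes v∈ws = v∈ws
... | no  v∉ws = ⊥-elim (1+n≰n (≤-trans (injective⇒≤ (lookup-injective (∉⇒unique-∷ v∉ws u))) m≤))

unique-long-except⇒∈ : ∀ {m w} {ws : List (Fin m)} → Unique ws → w ∉ ws → m ≤ suc (length ws) →
                       ∀ v → v ≢ w → v ∈ ws
unique-long-except⇒∈ u w∉ws m≤ v v≢w with unique-long⇒∈ (∉⇒unique-∷ w∉ws u) m≤ v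
... | here v≡w = ⊥-elim (v≢w v≡w)
... | there v∈ = v∈

∈-map⁻-injective : ∀ {A B : Set} {f : A → B} → Injective _≡_ _≡_ f →
                   ∀ {x ws} → f x ∈ map f ws → x ∈ ws
∈-map⁻-injective {f = f} f-inj {ws = ws} fx∈ with ∈-map⁻ f fx∈
... | y , y∈ws , fx≡fy = subst (_∈ ws) (sym (f-inj fx≡fy)) y∈ws

diPath-map : ∀ {V W : Set} {R : V → V → Set} {S : W → W → Set} {s t} (f : V → W) →
             Injective _≡_ _≡_ f → (∀ {a b} → R a b → S (f a) (f b)) →
             DiPath R s t → DiPath S (f s) (f t)
diPath-map f f-inj arc P = record
  { verts  = map f (verts P)
  ; linked = Linked.map⁺ (Linked.map arc (linked P))
  ; unique = Unique.map⁺ f-inj (unique P)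
  ; starts = trans (head-map {f = f} (verts P)) (cong (Maybe.map f) (starts P))
  ; ends   = trans (last-map f (verts P)) (cong (Maybe.map f) (ends P))
  }

odd≢even : ∀ i j → 1 + 2 * i ≢ 2 * j
odd≢even i j eq = 2≰1 (∣⇒≤ (∣m+n∣m⇒∣n 2∣2i+1 (m∣m*n i)))
  where
  2∣2i+1 : 2 ∣ 2 * i + 1
  2∣2i+1 = subst (2 ∣_) (sym (trans (+-comm (2 * i) 1) eq)) (m∣m*n j)
  2≰1 : ¬ 2 ≤ 1
  2≰1 (s≤s ())

odd< : ∀ {i k} → i < k → 1 + 2 * i < 2 * k
odd< {i} {k} i<k = subst (_≤ 2 * k) (*-suc 2 i) (*-monoʳ-≤ 2 i<k)

half≤pred : ∀ {m k} → 2 * m < 2 * k → m ≤ k ∸ 1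
half≤pred {m} {k} lt = <⇒≤pred (*-cancelˡ-< 2 m k lt)

module Absorber (k′ ℓ : ℕ) where

  k n order : ℕ
  k     = suc k′
  n     = 2 * k
  order = 3 + 2 * k * (ℓ + 1)

  V : Set
  V = Label k ℓ

  top : Fin (suc ℓ)
  top = fromℕ ℓ

  data Segment : Set where
    source absorbed sink : Segment
    path                 : Fin n → Segment

  vertices : Segment → List V
  vertices source   = [ xs ]
  vertices absorbed = [ xx ]
  vertices sink     = [ xt ]
  vertices (path a) = tabulate (pv a)

  entry exit : Segment → V
  entry source   = xs
  entry absorbed = xx
  entry sink     = xt
  entry (path a) = pv a fzero
  exit source    = xs
  exit absorbed  = xx
  exit sink      = xt
  exit (path a)  = pv a top

  segmentOf : V → Segment
  segmentOf xs       = source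
  segmentOf xx       = absorbed
  segmentOf xt       = sink
  segmentOf (pv a _) = path a

  ∈-vertices⇒segmentOf : ∀ {v} p → v ∈ vertices p → p ≡ segmentOf v
  ∈-vertices⇒segmentOf source   (here refl) = refl
  ∈-vertices⇒segmentOf absorbed (here refl) = refl
  ∈-vertices⇒segmentOf sink     (here refl) = refl
  ∈-vertices⇒segmentOf (path a) v∈ with ∈-tabulate⁻ {f = pv a} v∈
  ... | _ , refl = refl

  unique-vertices : ∀ p → Unique (vertices p)
  unique-vertices source   = [] ∷ []
  unique-vertices absorbed = [] ∷ []
  unique-vertices sink     = [] ∷ []
  unique-vertices (path a) = Unique.tabulate⁺ {f = pv a} λ { refl → refl }

  Joined : Segment → Segment → Set
  Joined p q = SpecArc k ℓ (exit p) (entry q)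

  walk : List Segment → List V
  walk = concatMap vertices

  head-vertices : ∀ p → head (vertices p) ≡ just (entry p)
  head-vertices source   = refl
  head-vertices absorbed = refl
  head-vertices sink     = refl
  head-vertices (path a) = refl

  last-vertices : ∀ p → last (vertices p) ≡ just (exit p)
  last-vertices source   = refl
  last-vertices absorbed = refl
  last-vertices sink     = refl
  last-vertices (path a) = last-tabulate (pv a)

  linked-vertices : ∀ p → Linked (SpecArc k ℓ) (vertices p)
  linked-vertices source   = [-]
  linked-vertices absorbed = [-]
  linked-vertices sink     = [-]
  linked-vertices (path a) =
    linked-tabulate (pv a) λ i → a-path a (inject₁ i) (fsuc i) (cong suc (sym (toℕ-inject₁ i)))

  linked-walk : ∀ {ρ} → Linked Joined ρ → Linked (SpecArc k ℓ) (walk ρ)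
  linked-walk = linked-concatMap vertices head-vertices last-vertices linked-vertices

  unique-walk : ∀ {ρ} → Unique ρ → Unique (walk ρ)
  unique-walk = unique-concatMap vertices unique-vertices λ p≢q (v∈p , v∈q) →
    p≢q (trans (∈-vertices⇒segmentOf _ v∈p) (sym (∈-vertices⇒segmentOf _ v∈q)))

  ∈-walk⇒segmentOf : ∀ {v ρ} → v ∈ walk ρ → segmentOf v ∈ ρ
  ∈-walk⇒segmentOf {ρ = ρ} v∈ with find (∈-concatMap⁻ vertices {xs = ρ} v∈)
  ... | p , p∈ρ , v∈p = subst (_∈ ρ) (∈-vertices⇒segmentOf p v∈p) p∈ρ

  length-walk-paths : ∀ σ → length (walk (map path σ)) ≡ length σ * suc ℓ
  length-walk-paths []      = refl
  length-walk-paths (a ∷ σ) =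
    trans (length-++ (vertices (path a)))
          (cong₂ _+_ (length-tabulate (pv {k} {ℓ} a)) (length-walk-paths σ))

  path-injective : ∀ {a b} → path a ≡ path b → a ≡ b
  path-injective refl = refl

  ∉-paths : ∀ {p σ} → (∀ {a} → p ≢ path a) → p ∉ map path σ
  ∉-paths p≢path p∈ with ∈-map⁻ path p∈
  ... | _ , _ , eq = p≢path eq

  route : List Segment → List Segment
  route ρ = source ∷ ρ ++ [ sink ]

  length-walk-route : ∀ ρ → length (walk (route ρ)) ≡ 2 + length (walk ρ)
  length-walk-route ρ = cong suc (begin
    length (walk (ρ ++ [ sink ]))        ≡⟨ cong length (concatMap-++ vertices ρ [ sink ]) ⟩
    length (walk ρ ++ [ xt ])            ≡⟨ length-++ (walk ρ) ⟩
    length (walk ρ) + 1                  ≡⟨ +-comm (length (walk ρ)) 1 ⟩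
    suc (length (walk ρ))                ∎)
    where open ≡-Reasoning

  unique-route : ∀ {ρ} → Unique ρ → source ∉ ρ → sink ∉ ρ → Unique (route ρ)
  unique-route {ρ} u source∉ sink∉ =
    ∉⇒unique-∷ source∉route (Unique.++⁺ u ([] ∷ []) λ { (v∈ρ , here refl) → sink∉ v∈ρ })
    where
    source∉route : source ∉ ρ ++ [ sink ]
    source∉route s∈ with ∈-++⁻ ρ s∈
    ... | inj₁ s∈ρ      = source∉ s∈ρ
    ... | inj₂ (here ())

  tour : ∀ ρ → Linked Joined (route ρ) → Unique (route ρ) → DiPath (SpecArc k ℓ) xs xt
  tour ρ l u = record
    { verts  = walk (route ρ)
    ; linked = linked-walk l
    ; unique = unique-walk u
    ; starts = refl
    ; ends   = trans (cong last (concatMap-++ vertices (source ∷ ρ) [ sink ]))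
                     (last-++ (walk (source ∷ ρ)) xt [])
    }

  -- path a is the paper's P_{a+1}, so even indices a are the paper's odd-numbered paths.
  Jump : Fin n → Fin n → Set
  Jump a b = Joined (path a) (path b)

  jump-next : ∀ {a b} → toℕ b ≡ suc (toℕ a) → Jump a b
  jump-next {a} {b} = a-ti-si+1 a top b fzero (toℕ-fromℕ ℓ) refl

  jump-skip-even : ∀ {a b m} → toℕ a ≡ 2 * m → toℕ b ≡ 2 * suc m → Jump a b
  jump-skip-even {a} {b} {m} a≡ b≡ =
    a-odd (suc m) a top b fzero (s≤s z≤n) (half≤pred {k = k} (subst (_< n) b≡ (toℕ<n b)))
      (toℕ-fromℕ ℓ) refl
      (trans (cong suc a≡) (sym (cong (_∸ 1) (*-suc 2 m))))
      (trans (cong suc b≡) (+-comm 1 (2 * suc m)))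

  jump-skip-odd : ∀ {a b m} → toℕ a ≡ 1 + 2 * m → toℕ b ≡ 1 + 2 * suc m → Jump a b
  jump-skip-odd {a} {b} {m} a≡ b≡ =
    a-even (suc m) a top b fzero (s≤s z≤n)
      (half≤pred {k = k} (<-trans (n<1+n _) (subst (_< n) b≡ (toℕ<n b))))
      (toℕ-fromℕ ℓ) refl
      (trans (cong suc a≡) (sym (*-suc 2 m)))
      (trans (cong suc b≡) (+-comm 2 (2 * suc m)))

  absorbing : List Segment
  absorbing = route (absorbed ∷ map path (allFin n))

  linked-absorbing : Linked Joined absorbing
  linked-absorbing =
    a-xs-x ∷ a-x-s1 fzero fzero refl refl ∷
    Linked.++⁺ (Linked.map⁺ (linked-tabulate id λ i → jump-next (cong suc (sym (toℕ-inject₁ i)))))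
               (connected-last (map path (allFin n)) last-paths
                  (a-t2k-xt _ top (toℕ-fromℕ ℓ) (cong suc (toℕ-fromℕ _))))
               [-]
    where
    last-paths : last (map path (allFin n)) ≡ just (path (fromℕ _))
    last-paths = trans (last-map path (allFin n)) (cong (Maybe.map path) (last-tabulate id))

  unique-absorbing : Unique absorbing
  unique-absorbing = unique-route
    (∉⇒unique-∷ (∉-paths λ ()) (Unique.map⁺ path-injective (Unique.allFin⁺ n)))
    (λ { (here ()) ; (there p∈) → ∉-paths (λ ()) p∈ })
    (λ { (here ()) ; (there p∈) → ∉-paths (λ ()) p∈ })

  absorbing-tour : DiPath (SpecArc k ℓ) xs xt
  absorbing-tour = tour (absorbed ∷ map path (allFin n)) linked-absorbing unique-absorbing

  length-absorbing : length (walk absorbing) ≡ order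
  length-absorbing = begin
    length (walk absorbing)                   ≡⟨ length-walk-route (absorbed ∷ map path (allFin n)) ⟩
    3 + length (walk (map path (allFin n)))   ≡⟨ cong (3 +_) (length-walk-paths (allFin n)) ⟩
    3 + length (allFin n) * suc ℓ             ≡⟨ cong (λ m → 3 + m * suc ℓ) (length-tabulate {n = n} id) ⟩
    3 + n * suc ℓ                             ≡⟨ cong (λ m → 3 + n * m) (+-comm 1 ℓ) ⟩
    order                                     ∎
    where open ≡-Reasoning

  odd even : Fin k → Fin n
  odd  i = fromℕ< (odd< (toℕ<n i))
  even i = fromℕ< (<⇒≤ (odd< (toℕ<n i)))

  toℕ-odd : ∀ i → toℕ (odd i) ≡ 1 + 2 * toℕ i
  toℕ-odd i = toℕ-fromℕ< (odd< (toℕ<n i))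

  toℕ-even : ∀ i → toℕ (even i) ≡ 2 * toℕ i
  toℕ-even i = toℕ-fromℕ< (<⇒≤ (odd< (toℕ<n i)))

  odd-injective : ∀ {i j} → odd i ≡ odd j → i ≡ j
  odd-injective {i} {j} eq = toℕ-injective (*-cancelˡ-≡ _ _ 2
    (suc-injective (trans (sym (toℕ-odd i)) (trans (cong toℕ eq) (toℕ-odd j)))))

  even-injective : ∀ {i j} → even i ≡ even j → i ≡ j
  even-injective {i} {j} eq = toℕ-injective (*-cancelˡ-≡ _ _ 2
    (trans (sym (toℕ-even i)) (trans (cong toℕ eq) (toℕ-even j))))

  odds-disjoint-evens : Disjoint (tabulate odd) (tabulate even)
  odds-disjoint-evens (v∈odds , v∈evens)
    with ∈-tabulate⁻ {f = odd} v∈odds | ∈-tabulate⁻ {f = even} v∈evens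
  ... | i , refl | j , eq =
    odd≢even (toℕ i) (toℕ j) (trans (sym (toℕ-odd i)) (trans (cong toℕ eq) (toℕ-even j)))

  reordered : List (Fin n)
  reordered = tabulate odd ++ tabulate even

  nonabsorbing : List Segment
  nonabsorbing = route (map path reordered)

  linked-nonabsorbing : Linked Joined nonabsorbing
  linked-nonabsorbing =
    a-xs-s2 (odd fzero) fzero refl (cong suc (toℕ-odd fzero)) ∷
    Linked.++⁺ (Linked.map⁺ (Linked.++⁺ linked-odds odds→evens linked-evens))
               (connected-last (map path reordered) last-reordered
                  (a-t2k-1-xt (even (fromℕ k′)) top (toℕ-fromℕ ℓ) last-even-index))
               [-]
    where
    open ≡-Reasoning
    linked-odds : Linked Jump (tabulate odd)
    linked-odds = linked-tabulate odd λ i →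
      jump-skip-odd (trans (toℕ-odd (inject₁ i)) (cong (λ m → 1 + 2 * m) (toℕ-inject₁ i)))
                    (toℕ-odd (fsuc i))
    linked-evens : Linked Jump (tabulate even)
    linked-evens = linked-tabulate even λ i →
      jump-skip-even (trans (toℕ-even (inject₁ i)) (cong (2 *_) (toℕ-inject₁ i)))
                     (toℕ-even (fsuc i))
    last-odd-index : suc (toℕ (odd (fromℕ k′))) ≡ 2 * k
    last-odd-index = begin
      suc (toℕ (odd (fromℕ k′)))   ≡⟨ cong suc (toℕ-odd (fromℕ k′)) ⟩
      2 + 2 * toℕ (fromℕ k′)      ≡⟨ cong (λ m → 2 + 2 * m) (toℕ-fromℕ k′) ⟩
      2 + 2 * k′                  ≡⟨ *-suc 2 k′ ⟨
      2 * k                       ∎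
    odds→evens : Connected Jump (last (tabulate odd)) (head (tabulate even))
    odds→evens = connected-last (tabulate odd) (last-tabulate odd)
      (a-t2k-s1 (odd (fromℕ k′)) top (even fzero) fzero (toℕ-fromℕ ℓ) refl last-odd-index
                (toℕ-even fzero))
    last-reordered : last (map path reordered) ≡ just (path (even (fromℕ k′)))
    last-reordered = trans (last-map path reordered) (cong (Maybe.map path) (begin
      last (tabulate odd ++ even fzero ∷ tabulate (even ∘ fsuc))
        ≡⟨ last-++ (tabulate odd) (even fzero) (tabulate (even ∘ fsuc)) ⟩
      last (tabulate even)
        ≡⟨ last-tabulate even ⟩
      just (even (fromℕ k′))  ∎))
    last-even-index : suc (toℕ (even (fromℕ k′))) ≡ 2 * k ∸ 1
    last-even-index = begin
      suc (toℕ (even (fromℕ k′)))  ≡⟨ cong suc (toℕ-even (fromℕ k′)) ⟩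
      suc (2 * toℕ (fromℕ k′))     ≡⟨ cong (λ m → suc (2 * m)) (toℕ-fromℕ k′) ⟩
      suc (2 * k′)                 ≡⟨ cong (_∸ 1) (*-suc 2 k′) ⟨
      2 * k ∸ 1                    ∎

  unique-nonabsorbing : Unique nonabsorbing
  unique-nonabsorbing = unique-route
    (Unique.map⁺ path-injective
      (Unique.++⁺ (Unique.tabulate⁺ odd-injective) (Unique.tabulate⁺ even-injective) odds-disjoint-evens))
    (∉-paths λ ())
    (∉-paths λ ())

  nonabsorbing-tour : DiPath (SpecArc k ℓ) xs xt
  nonabsorbing-tour = tour (map path reordered) linked-nonabsorbing unique-nonabsorbing

  length-nonabsorbing : suc (length (walk nonabsorbing)) ≡ order
  length-nonabsorbing = begin
    suc (length (walk nonabsorbing))          ≡⟨ cong suc (length-walk-route (map path reordered)) ⟩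
    3 + length (walk (map path reordered))    ≡⟨ cong (3 +_) (length-walk-paths reordered) ⟩
    3 + length reordered * suc ℓ              ≡⟨ cong (λ m → 3 + m * suc ℓ) length-reordered ⟩
    3 + n * suc ℓ                             ≡⟨ cong (λ m → 3 + n * m) (+-comm 1 ℓ) ⟩
    order                                     ∎
    where
    open ≡-Reasoning
    length-reordered : length reordered ≡ n
    length-reordered = trans (length-++ (tabulate odd))
      (cong₂ _+_ (length-tabulate odd) (trans (length-tabulate even) (sym (+-identityʳ k))))

  xx∉walk-nonabsorbing : xx ∉ walk nonabsorbing
  xx∉walk-nonabsorbing xx∈ with ∈-walk⇒segmentOf {ρ = nonabsorbing} xx∈
  ... | there absorbed∈ with ∈-++⁻ (map path reordered) absorbed∈
  ...   | inj₁ absorbed∈paths = ∉-paths (λ ()) absorbed∈paths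
  ...   | inj₂ (here ())

lemma5p2 : (k ℓ : ℕ) → 1 ≤ k → 1 ≤ ℓ →
    (E : Fin (3 + 2 * k * (ℓ + 1)) → Fin (3 + 2 * k * (ℓ + 1)) → Set) →
    (f : Label k ℓ → Fin (3 + 2 * k * (ℓ + 1))) →
    Injective _≡_ _≡_ f →
    ((u v : Fin (3 + 2 * k * (ℓ + 1))) →
      E u v ⇔ ∃₂ λ a b → (u ≡ f a) × (v ≡ f b) × SpecArc k ℓ a b) →
    (Σ (DiPath E (f xs) (f xt)) Spanning)
      × (Σ (DiPath E (f xs) (f xt)) (SpanningExcept (f xx)))
lemma5p2 (suc k′) ℓ _ _ E f f-inj E⇔ =
  (absorbing-path , spanning) , (nonabsorbing-path , fxx∉ , spanning-except)
  where
  open Absorber k′ ℓ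
  arc : ∀ {a b} → SpecArc k ℓ a b → E (f a) (f b)
  arc {a} {b} ab = Equivalence.from (E⇔ (f a) (f b)) (a , b , refl , refl , ab)

  absorbing-path nonabsorbing-path : DiPath E (f xs) (f xt)
  absorbing-path    = diPath-map f f-inj arc absorbing-tour
  nonabsorbing-path = diPath-map f f-inj arc nonabsorbing-tour

  spanning : Spanning absorbing-path
  spanning = unique-long⇒∈ (unique absorbing-path)
    (≤-reflexive (sym (trans (length-map f (walk absorbing)) length-absorbing)))

  fxx∉ : f xx ∉ verts nonabsorbing-path
  fxx∉ = xx∉walk-nonabsorbing ∘ ∈-map⁻-injective f-inj

  spanning-except : ∀ v → v ≢ f xx → v ∈ verts nonabsorbing-path
  spanning-except = unique-long-except⇒∈ (unique nonabsorbing-path) fxx∉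
    (≤-reflexive (sym (trans (cong suc (length-map f (walk nonabsorbing))) length-nonabsorbing)))
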